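{- Let $X$ be a complete lattice, $O$ a quasi-overlap function on $X$ and $\rho$ a Scott-automorphism of $X$. Define $O^{\rho}:X^2\to X$ by $O^{\rho}(x,y)=\rho^{ -1}(O(\rho(x),\rho(y)))$. Then $O^{\rho}$ is a quasi-overlap function on $X$. Moreover, if $O$ is Scott-continuous, then $O^{\rho}$ is also Scott-continuous.
   Context: $X$ has bottom $0$ and top $1$. A quasi-overlap function on $X$ is $O:X^2\to X$ with (OL1) $O(x,y)=O(y,x)$; (OL2) $O(x,y)=0$ iff $x=0$ or $y=0$; (OL3) $O(x,y)=1$ iff $x=y=1$; (OL4) $O$ non-decreasing in each variable. A Scott-automorphism is a map $\rho:X\to X$ that is bijective, continuous with respect to the Scott topology (open sets: upward closed sets $A$ such that every directed $D$ with $\sup D\in A$ meets $A$), and satisfies $x\leq y\iff\rho(x)\leq\rho(y)$. A function is Scott-continuous if it preserves suprema of directed sets (with $X^2$ ordered componentwise). -}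

module Defs where

open import Level using (Level; _⊔_; suc)
open import Data.Product using (Σ; ∃; _×_; _,_; proj₁; proj₂)
open import Data.Sum using (_⊎_)
open import Relation.Unary using (Pred; _∈_)
open import Relation.Binary using (Rel; IsPartialOrder)
open import Relation.Binary.PropositionalEquality using (_≡_)
open import Function using (_⇔_)
open import Function.Definitions using (Bijective)

record CompleteLattice (c ℓ : Level) : Set (suc (c ⊔ ℓ)) where
  field
    Carrier        : Set c
    _≤_            : Rel Carrier ℓ
    isPartialOrder : IsPartialOrder _≡_ _≤_
    ⋁              : Pred Carrier (c ⊔ ℓ) → Carrier
    ⋁-upper        : ∀ (S : Pred Carrier (c ⊔ ℓ)) x → x ∈ S → x ≤ ⋁ S
    ⋁-least        : ∀ (S : Pred Carrier (c ⊔ ℓ)) u → (∀ x → x ∈ S → x ≤ u) → ⋁ S ≤ u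

module _ {c ℓ : Level} (L : CompleteLattice c ℓ) where
  open CompleteLattice L

  private
    X = Carrier

  ⊥L : X
  ⊥L = ⋁ (λ _ → Level.Lift (c ⊔ ℓ) Data.Empty.⊥)
    where import Data.Empty

  ⊤L : X
  ⊤L = ⋁ (λ _ → Level.Lift (c ⊔ ℓ) Data.Unit.⊤)
    where import Data.Unit

  record IsQuasiOverlap (O : X → X → X) : Set (c ⊔ ℓ) where
    field
      OL1 : ∀ x y → O x y ≡ O y x
      OL2 : ∀ x y → (O x y ≡ ⊥L) ⇔ (x ≡ ⊥L ⊎ y ≡ ⊥L)
      OL3 : ∀ x y → (O x y ≡ ⊤L) ⇔ (x ≡ ⊤L × y ≡ ⊤L)
      OL4 : ∀ x₁ x₂ y₁ y₂ → x₁ ≤ x₂ → y₁ ≤ y₂ → O x₁ y₁ ≤ O x₂ y₂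

  Directed : Pred X (c ⊔ ℓ) → Set (c ⊔ ℓ)
  Directed D = (∃ λ d → d ∈ D)
             × (∀ x y → x ∈ D → y ∈ D → ∃ λ z → z ∈ D × x ≤ z × y ≤ z)

  UpperClosed : Pred X (c ⊔ ℓ) → Set (c ⊔ ℓ)
  UpperClosed A = ∀ x y → x ≤ y → x ∈ A → y ∈ A

  ScottOpen : Pred X (c ⊔ ℓ) → Set (suc (c ⊔ ℓ))
  ScottOpen A = UpperClosed A
              × (∀ (D : Pred X (c ⊔ ℓ)) → Directed D → ⋁ D ∈ A → ∃ λ d → d ∈ D × d ∈ A)

  ScottTopContinuous : (X → X) → Set (suc (c ⊔ ℓ))
  ScottTopContinuous f = ∀ (A : Pred X (c ⊔ ℓ)) → ScottOpen A → ScottOpen (λ x → f x ∈ A)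

  OrderIso : (X → X) → Set (c ⊔ ℓ)
  OrderIso f = ∀ x y → (x ≤ y) ⇔ (f x ≤ f y)

  record IsScottAutomorphism (ρ : X → X) : Set (suc (c ⊔ ℓ)) where
    field
      bijective  : Bijective _≡_ _≡_ ρ
      continuous : ScottTopContinuous ρ
      order      : OrderIso ρ

  inverse : (ρ : X → X) → Bijective _≡_ _≡_ ρ → X → X
  inverse ρ b y = proj₁ (proj₂ b y)

  conjugate : (O : X → X → X) (ρ : X → X) → Bijective _≡_ _≡_ ρ → X → X → X
  conjugate O ρ b x y = inverse ρ b (O (ρ x) (ρ y))

  _≤²_ : X × X → X × X → Set ℓ
  (x₁ , y₁) ≤² (x₂ , y₂) = (x₁ ≤ x₂) × (y₁ ≤ y₂)

  Directed² : Pred (X × X) (c ⊔ ℓ) → Set (c ⊔ ℓ)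
  Directed² D = (∃ λ p → p ∈ D)
              × (∀ p q → p ∈ D → q ∈ D → ∃ λ r → r ∈ D × p ≤² r × q ≤² r)

  ⋁² : Pred (X × X) (c ⊔ ℓ) → X × X
  ⋁² D = ⋁ (λ x → ∃ λ y → (x , y) ∈ D) , ⋁ (λ y → ∃ λ x → (x , y) ∈ D)

  ScottContinuous : (X → X → X) → Set (suc (c ⊔ ℓ))
  ScottContinuous O = ∀ (D : Pred (X × X) (c ⊔ ℓ)) → Directed² D →
    O (proj₁ (⋁² D)) (proj₂ (⋁² D)) ≡ ⋁ (λ z → ∃ λ p → p ∈ D × O (proj₁ p) (proj₂ p) ≡ z)

-- Conjugating by ρ is transport of structure along an order automorphism of X:
-- ρ and ρ⁻¹ are monotone, fix ⊥ and ⊤, and carry suprema to suprema.  Each of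
-- (OL1)–(OL4) and Scott-continuity of O is therefore inherited by O^ρ, the directed
-- set D ⊆ X² being replaced by its image under ρ × ρ.
module Submission where

open import Defs
open import Data.Product using (_×_; _,_; proj₁; proj₂; ∃; map)
open import Data.Sum using (_⊎_)
open import Data.Product.Function.NonDependent.Propositional using (_×-⇔_)
open import Data.Sum.Function.Propositional using (_⊎-⇔_)
open import Function using (_⇔_; mk⇔; Equivalence)
open import Function.Definitions using (Bijective)
open import Function.Properties.Equivalence using (⇔-setoid)
open import Relation.Binary using (IsPartialOrder)
open import Relation.Binary.PropositionalEquality
  using (_≡_; refl; sym; trans; cong; cong₂; subst; subst₂; module ≡-Reasoning)
open import Relation.Unary using (Pred; _∈_)
open import Level using (_⊔_)

module OrderAutomorphism {c ℓ} (L : CompleteLattice c ℓ)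
    (ρ : CompleteLattice.Carrier L → CompleteLattice.Carrier L)
    (bij : Bijective _≡_ _≡_ ρ) (order : OrderIso L ρ) where
  open CompleteLattice L
  open IsPartialOrder isPartialOrder using (antisym)

  private
    X = Carrier

  σ : X → X
  σ = inverse L ρ bij

  ρ∘σ : ∀ y → ρ (σ y) ≡ y
  ρ∘σ y = proj₂ (proj₂ bij y) refl

  ρ-injective : ∀ {x y} → ρ x ≡ ρ y → x ≡ y
  ρ-injective = proj₁ bij

  σ∘ρ : ∀ x → σ (ρ x) ≡ x
  σ∘ρ x = ρ-injective (ρ∘σ (ρ x))

  ρ-mono : ∀ {x y} → x ≤ y → ρ x ≤ ρ y
  ρ-mono {x} {y} = Equivalence.to (order x y)

  ρ-reflects : ∀ {x y} → ρ x ≤ ρ y → x ≤ y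
  ρ-reflects {x} {y} = Equivalence.from (order x y)

  σ-mono : ∀ {x y} → x ≤ y → σ x ≤ σ y
  σ-mono {x} {y} x≤y = ρ-reflects (subst₂ _≤_ (sym (ρ∘σ x)) (sym (ρ∘σ y)) x≤y)

  ρ≤⇒≤σ : ∀ {x y} → ρ x ≤ y → x ≤ σ y
  ρ≤⇒≤σ {x} {y} ρx≤y = ρ-reflects (subst (ρ x ≤_) (sym (ρ∘σ y)) ρx≤y)

  σ≤⇒≤ρ : ∀ {x y} → σ x ≤ y → x ≤ ρ y
  σ≤⇒≤ρ {x} σx≤y = subst (_≤ _) (ρ∘σ x) (ρ-mono σx≤y)

  ≤σ⇒ρ≤ : ∀ {x y} → x ≤ σ y → ρ x ≤ y
  ≤σ⇒ρ≤ {y = y} x≤σy = subst (_ ≤_) (ρ∘σ y) (ρ-mono x≤σy)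

  ⊥L-least : ∀ x → ⊥L L ≤ x
  ⊥L-least x = ⋁-least _ x (λ _ ())

  ⊤L-greatest : ∀ x → x ≤ ⊤L L
  ⊤L-greatest x = ⋁-upper _ x _

  ρ-⊥L : ρ (⊥L L) ≡ ⊥L L
  ρ-⊥L = antisym (≤σ⇒ρ≤ (⊥L-least _)) (⊥L-least _)

  ρ-⊤L : ρ (⊤L L) ≡ ⊤L L
  ρ-⊤L = antisym (⊤L-greatest _) (σ≤⇒≤ρ (⊤L-greatest _))

  ρ≡-fixed⇔ : ∀ {e} → ρ e ≡ e → ∀ x → (ρ x ≡ e) ⇔ (x ≡ e)
  ρ≡-fixed⇔ ρe≡e x = mk⇔ (λ ρx≡e → ρ-injective (trans ρx≡e (sym ρe≡e)))
                          (λ x≡e → trans (cong ρ x≡e) ρe≡e)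

  σ≡-fixed⇔ : ∀ {e} → ρ e ≡ e → ∀ y → (σ y ≡ e) ⇔ (y ≡ e)
  σ≡-fixed⇔ ρe≡e y = mk⇔ (λ σy≡e → trans (sym (ρ∘σ y)) (trans (cong ρ σy≡e) ρe≡e))
                          (λ y≡e → trans (cong σ (trans y≡e (sym ρe≡e))) (σ∘ρ _))

  ρ-⋁ : (S T : Pred X (c ⊔ ℓ)) → (∀ w → w ∈ T → ρ w ∈ S) → (∀ s → s ∈ S → σ s ∈ T) →
        ρ (⋁ T) ≡ ⋁ S
  ρ-⋁ S T ρT⊆S σS⊆T = antisym ρ⋁T≤⋁S ⋁S≤ρ⋁T
    where
    ρ⋁T≤⋁S : ρ (⋁ T) ≤ ⋁ S
    ρ⋁T≤⋁S = ≤σ⇒ρ≤ (⋁-least T _ (λ w w∈T → ρ≤⇒≤σ (⋁-upper S (ρ w) (ρT⊆S w w∈T))))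

    ⋁S≤ρ⋁T : ⋁ S ≤ ρ (⋁ T)
    ⋁S≤ρ⋁T = ⋁-least S _ (λ s s∈S → σ≤⇒≤ρ (⋁-upper T (σ s) (σS⊆T s s∈S)))

  σ-⋁ : (S T : Pred X (c ⊔ ℓ)) → (∀ w → w ∈ T → ρ w ∈ S) → (∀ s → s ∈ S → σ s ∈ T) →
        σ (⋁ S) ≡ ⋁ T
  σ-⋁ S T ρT⊆S σS⊆T = trans (cong σ (sym (ρ-⋁ S T ρT⊆S σS⊆T))) (σ∘ρ _)

  image² : Pred (X × X) (c ⊔ ℓ) → Pred (X × X) (c ⊔ ℓ)
  image² D q = map σ σ q ∈ D

  ∈image² : ∀ D x y → (x , y) ∈ D → (ρ x , ρ y) ∈ image² D
  ∈image² D x y = subst D (sym (cong₂ _,_ (σ∘ρ x) (σ∘ρ y)))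

  image²-directed : ∀ {D} → Directed² L D → Directed² L (image² D)
  image²-directed {D} (((x , y) , xy∈D) , upper) =
    ((ρ x , ρ y) , ∈image² D x y xy∈D) , image²-upper
    where
    image²-upper : ∀ p q → p ∈ image² D → q ∈ image² D →
                   ∃ λ r → r ∈ image² D × _≤²_ L p r × _≤²_ L q r
    image²-upper p q p∈ q∈ with upper _ _ p∈ q∈
    ... | (r₁ , r₂) , r∈D , (p₁≤ , p₂≤) , (q₁≤ , q₂≤) =
      (ρ r₁ , ρ r₂) , ∈image² D r₁ r₂ r∈D ,
      (σ≤⇒≤ρ p₁≤ , σ≤⇒≤ρ p₂≤) , (σ≤⇒≤ρ q₁≤ , σ≤⇒≤ρ q₂≤)

module Conjugate {c ℓ} (L : CompleteLattice c ℓ)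
    (O : CompleteLattice.Carrier L → CompleteLattice.Carrier L → CompleteLattice.Carrier L)
    (ρ : CompleteLattice.Carrier L → CompleteLattice.Carrier L)
    (bij : Bijective _≡_ _≡_ ρ) (order : OrderIso L ρ) where
  open CompleteLattice L
  open OrderAutomorphism L ρ bij order

  private
    X = Carrier
    Oρ = conjugate L O ρ bij

  conjugate-isQuasiOverlap : IsQuasiOverlap L O → IsQuasiOverlap L Oρ
  conjugate-isQuasiOverlap qo = record
    { OL1 = λ x y → cong σ (OL1 (ρ x) (ρ y))
    ; OL2 = OL2ρ
    ; OL3 = OL3ρ
    ; OL4 = λ _ _ _ _ x₁≤x₂ y₁≤y₂ → σ-mono (OL4 _ _ _ _ (ρ-mono x₁≤x₂) (ρ-mono y₁≤y₂))
    }
    where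
    open IsQuasiOverlap qo
    open import Relation.Binary.Reasoning.Setoid (⇔-setoid c)

    OL2ρ : ∀ x y → (Oρ x y ≡ ⊥L L) ⇔ (x ≡ ⊥L L ⊎ y ≡ ⊥L L)
    OL2ρ x y = begin
      Oρ x y ≡ ⊥L L                       ≈⟨ σ≡-fixed⇔ ρ-⊥L _ ⟩
      O (ρ x) (ρ y) ≡ ⊥L L                ≈⟨ OL2 (ρ x) (ρ y) ⟩
      (ρ x ≡ ⊥L L ⊎ ρ y ≡ ⊥L L)           ≈⟨ ρ≡-fixed⇔ ρ-⊥L x ⊎-⇔ ρ≡-fixed⇔ ρ-⊥L y ⟩
      (x ≡ ⊥L L ⊎ y ≡ ⊥L L)               ∎

    OL3ρ : ∀ x y → (Oρ x y ≡ ⊤L L) ⇔ (x ≡ ⊤L L × y ≡ ⊤L L)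
    OL3ρ x y = begin
      Oρ x y ≡ ⊤L L                       ≈⟨ σ≡-fixed⇔ ρ-⊤L _ ⟩
      O (ρ x) (ρ y) ≡ ⊤L L                ≈⟨ OL3 (ρ x) (ρ y) ⟩
      (ρ x ≡ ⊤L L × ρ y ≡ ⊤L L)           ≈⟨ ρ≡-fixed⇔ ρ-⊤L x ×-⇔ ρ≡-fixed⇔ ρ-⊤L y ⟩
      (x ≡ ⊤L L × y ≡ ⊤L L)               ∎

  conjugate-scottContinuous : ScottContinuous L O → ScottContinuous L Oρ
  conjugate-scottContinuous O-continuous D D-directed = begin
    σ (O (ρ (⋁ (first D))) (ρ (⋁ (second D))))
      ≡⟨ cong σ (cong₂ O (ρ-⋁ _ _ ρ-first σ-first) (ρ-⋁ _ _ ρ-second σ-second)) ⟩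
    σ (O (⋁ (first (image² D))) (⋁ (second (image² D))))
      ≡⟨ cong σ (O-continuous (image² D) (image²-directed D-directed)) ⟩
    σ (⋁ (values O (image² D)))
      ≡⟨ σ-⋁ _ _ ρ-values σ-values ⟩
    ⋁ (values Oρ D)                                   ∎
    where
    open ≡-Reasoning

    first second : Pred (X × X) (c ⊔ ℓ) → Pred X (c ⊔ ℓ)
    first E x = ∃ λ y → (x , y) ∈ E
    second E y = ∃ λ x → (x , y) ∈ E

    values : (X → X → X) → Pred (X × X) (c ⊔ ℓ) → Pred X (c ⊔ ℓ)
    values F E z = ∃ λ p → p ∈ E × F (proj₁ p) (proj₂ p) ≡ z

    ρ-first : ∀ x → x ∈ first D → ρ x ∈ first (image² D)
    ρ-first x (y , xy∈D) = ρ y , ∈image² D x y xy∈D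

    σ-first : ∀ x → x ∈ first (image² D) → σ x ∈ first D
    σ-first x (y , xy∈) = σ y , xy∈

    ρ-second : ∀ y → y ∈ second D → ρ y ∈ second (image² D)
    ρ-second y (x , xy∈D) = ρ x , ∈image² D x y xy∈D

    σ-second : ∀ y → y ∈ second (image² D) → σ y ∈ second D
    σ-second y (x , xy∈) = σ x , xy∈

    ρ-values : ∀ z → z ∈ values Oρ D → ρ z ∈ values O (image² D)
    ρ-values z ((x , y) , xy∈D , Oρxy≡z) =
      (ρ x , ρ y) , ∈image² D x y xy∈D , trans (sym (ρ∘σ _)) (cong ρ Oρxy≡z)

    σ-values : ∀ z → z ∈ values O (image² D) → σ z ∈ values Oρ D
    σ-values z ((a , b) , ab∈ , Oab≡z) =
      (σ a , σ b) , ab∈ , cong σ (trans (cong₂ O (ρ∘σ a) (ρ∘σ b)) Oab≡z)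

proposition4p1 : ∀ {c ℓ} (L : CompleteLattice c ℓ)
    (O : CompleteLattice.Carrier L → CompleteLattice.Carrier L → CompleteLattice.Carrier L)
    (ρ : CompleteLattice.Carrier L → CompleteLattice.Carrier L) →
    IsQuasiOverlap L O →
    (aut : IsScottAutomorphism L ρ) →
    IsQuasiOverlap L (conjugate L O ρ (IsScottAutomorphism.bijective aut))
    × (ScottContinuous L O → ScottContinuous L (conjugate L O ρ (IsScottAutomorphism.bijective aut)))
proposition4p1 L O ρ qo aut =
  conjugate-isQuasiOverlap qo , conjugate-scottContinuous
  where
  open IsScottAutomorphism aut using (bijective; order)
  open Conjugate L O ρ bijective order
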